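{- Let $U$ be a (not necessarily commutative) group. Let $\widetilde J$ be a function assigning to each primitive segment $(\alpha,\beta)$ an element $\widetilde J(\alpha,\beta)\in U$ such that $\widetilde J(\beta,\alpha)\widetilde J(\alpha,\beta)=1$ for every primitive segment $(\alpha,\beta)$, and $\widetilde J(\gamma,\alpha)\widetilde J(\beta,\gamma)\widetilde J(\alpha,\beta)=1$ whenever $(\alpha,\beta),(\beta,\gamma),(\gamma,\alpha)$ are all primitive segments. Then there exists a unique $U$-valued pseudo-measure $J$ whose restriction to primitive segments is $\widetilde J$.
   Context: $\mathbf{P}^1(\mathbb{Q})=\mathbb{Q}\cup\{\infty\}$. A $U$-valued pseudo-measure is a function $J:\mathbf{P}^1(\mathbb{Q})^2\to U$, $(\alpha,\beta)\mapsto J(\alpha,\beta)$, such that for all $\alpha,\beta,\gamma$: $J(\alpha,\alpha)=1$, $J(\beta,\alpha)J(\alpha,\beta)=1$, and $J(\gamma,\alpha)J(\beta,\gamma)J(\alpha,\beta)=1$. A primitive segment is an ordered pair $(\alpha,\beta)$ in $\mathbf{P}^1(\mathbb{Q})$ with $\alpha=a/c$, $\beta=b/d$ in lowest terms ($\infty=\pm1/0$) and $ad-bc=\pm1$. -}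

module Defs where

open import Level using (Level; _⊔_)
open import Data.Integer using (ℤ; +_; -_; _*_; _-_)
open import Data.Rational using (ℚ; ↥_; ↧_)
open import Data.Sum using (_⊎_)
open import Relation.Binary.PropositionalEquality using (_≡_)
open import Algebra.Bundles using (Group)
open import Data.Product using (_×_)

data P¹ℚ : Set where
  fin : ℚ → P¹ℚ
  ∞   : P¹ℚ

-- lowest-terms numerator/denominator: q = ↥q / ↧q (coprime, ↧q > 0); ∞ = 1/0
num : P¹ℚ → ℤ
num (fin q) = ↥ q
num ∞       = + 1

den : P¹ℚ → ℤ
den (fin q) = ↧ q
den ∞       = + 0

-- (α, β) with α = a/c, β = b/d in lowest terms is primitive iff ad - bc = ±1
-- (independent of the choice of signs of the lowest-terms representations)
Primitive : P¹ℚ → P¹ℚ → Set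
Primitive α β =
  (num α * den β - num β * den α ≡ + 1) ⊎ (num α * den β - num β * den α ≡ - (+ 1))

module _ {c ℓ : Level} (U : Group c ℓ) where
  open Group U

  IsPseudoMeasure : (P¹ℚ → P¹ℚ → Carrier) → Set ℓ
  IsPseudoMeasure J =
    (∀ α → J α α ≈ ε) ×
    (∀ α β → J β α ∙ J α β ≈ ε) ×
    (∀ α β γ → J γ α ∙ J β γ ∙ J α β ≈ ε)

{-# OPTIONS --safe #-}
-- Each rational q = b/d has a primitive neighbour of smaller denominator, its parent: reduce
-- a Bézout relation x·d − b·y = ±1 modulo d in y. Following parents leads to ∞, so a
-- pseudo-measure extending J̃ is forced to satisfy J(∞, α) = P α for the potential P given by
-- P ∞ = 1 and P q = J̃(parent q, q) · P(parent q); conversely J(α, β) = P β · (P α)⁻¹ is a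
-- pseudo-measure.
-- It agrees with J̃ on every primitive segment by induction on denominators: if α and γ are
-- primitive neighbours of β of smaller denominators, then den β · det(α, γ) is a combination
-- of two determinants ±1 with coefficients den γ, den α < den β, so α = γ or (α, γ) is
-- primitive, and the triangle relation carries agreement from (α, parent β) and
-- (parent β, β) over to (α, β).
module Submission where

open import Defs
open import Level using (Level; _⊔_)
open import Algebra.Bundles using (Group)
open import Data.Product using (Σ; _×_)

open import Data.Product using (_,_; proj₁; proj₂; ∃-syntax)
open import Data.Sum using (_⊎_; inj₁; inj₂; map₁)
open import Data.Nat as ℕ using (ℕ; zero; suc; _≤_; _<_; s≤s)
import Data.Nat.Properties as ℕ
open import Data.Nat.Coprimality as Coprimality using (coprime-Bézout)
open import Data.Nat.Divisibility using (_∣_; ∣1⇒≡1)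
open import Data.Nat.GCD using (module Bézout)
open import Data.Nat.Induction using (<-wellFounded)
open import Data.Integer as ℤ using (ℤ; +_; -[1+_]; -_; _*_; _-_; ∣_∣; 0ℤ; 1ℤ; -1ℤ)
import Data.Integer.Properties as ℤ
open import Data.Integer.Coprimality using (Coprime)
open import Data.Integer.DivMod using (_%ℕ_; _/ℕ_; a≡a%ℕn+[a/ℕn]*n; n%ℕd<d)
import Data.Integer.Divisibility.Signed as ℤ
open import Data.Integer.Tactic.RingSolver using (solve-∀)
open import Data.Rational using (ℚ; mkℚ; *≡*)
open import Data.Rational.Properties using (≃⇒≡)
open import Induction.WellFounded using (Acc; acc)
open import Relation.Binary.Definitions using (tri<; tri≈; tri>)
open import Relation.Binary.PropositionalEquality as ≡ using (_≡_; cong; cong₂; subst; subst₂)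
open import Relation.Nullary using (contradiction)
import Algebra.Properties.Group as GroupProperties
import Relation.Binary.Reasoning.Setoid as SetoidReasoning

IsUnit : ℤ → Set
IsUnit i = i ≡ 1ℤ ⊎ i ≡ -1ℤ

IsUnit-neg : ∀ {i} → IsUnit i → IsUnit (- i)
IsUnit-neg (inj₁ ≡.refl) = inj₂ ≡.refl
IsUnit-neg (inj₂ ≡.refl) = inj₁ ≡.refl

IsUnit⇒∣i∣≡1 : ∀ {i} → IsUnit i → ∣ i ∣ ≡ 1
IsUnit⇒∣i∣≡1 (inj₁ ≡.refl) = ≡.refl
IsUnit⇒∣i∣≡1 (inj₂ ≡.refl) = ≡.refl

∣i*u∣≡∣i∣ : ∀ i {u} → IsUnit u → ∣ i * u ∣ ≡ ∣ i ∣
∣i*u∣≡∣i∣ i {u} unit =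
  ≡.trans (ℤ.abs-* i u) (≡.trans (cong (∣ i ∣ ℕ.*_) (IsUnit⇒∣i∣≡1 unit)) (ℕ.*-identityʳ ∣ i ∣))

∣i∣<2⇒i≡0⊎IsUnit : ∀ i → ∣ i ∣ < 2 → i ≡ 0ℤ ⊎ IsUnit i
∣i∣<2⇒i≡0⊎IsUnit (+ 0)           _                = inj₁ ≡.refl
∣i∣<2⇒i≡0⊎IsUnit (+ 1)           _                = inj₂ (inj₁ ≡.refl)
∣i∣<2⇒i≡0⊎IsUnit -[1+ 0 ]        _                = inj₂ (inj₂ ≡.refl)
∣i∣<2⇒i≡0⊎IsUnit (+ suc (suc _)) (s≤s (s≤s ()))
∣i∣<2⇒i≡0⊎IsUnit -[1+ suc _ ]    (s≤s (s≤s ()))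

1+j≡i⇒i-j≡1 : ∀ {i j} → 1ℤ ℤ.+ j ≡ i → i - j ≡ 1ℤ
1+j≡i⇒i-j≡1 {j = j} ≡.refl = lemma j
  where
  lemma : ∀ j → (1ℤ ℤ.+ j) - j ≡ 1ℤ
  lemma = solve-∀

1+i≡j⇒i-j≡-1 : ∀ {i j} → 1ℤ ℤ.+ i ≡ j → i - j ≡ -1ℤ
1+i≡j⇒i-j≡-1 {i = i} ≡.refl = lemma i
  where
  lemma : ∀ i → i - (1ℤ ℤ.+ i) ≡ -1ℤ
  lemma = solve-∀

1+m*n≡o*p⇒ℤ : ∀ m n o p → 1 ℕ.+ m ℕ.* n ≡ o ℕ.* p → 1ℤ ℤ.+ + m * + n ≡ + o * + p
1+m*n≡o*p⇒ℤ m n o p eq = subst₂ (λ u v → 1ℤ ℤ.+ u ≡ v) (ℤ.pos-* m n) (ℤ.pos-* o p) (cong +_ eq)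

bézout⇒unimodular : ∀ {m n} → Bézout.Identity 1 m n → ∃[ x ] ∃[ y ] IsUnit (+ x * + m - + y * + n)
bézout⇒unimodular {m} {n} (Bézout.+- x y eq) = x , y , inj₁ (1+j≡i⇒i-j≡1 (1+m*n≡o*p⇒ℤ y n x m eq))
bézout⇒unimodular {m} {n} (Bézout.-+ x y eq) = x , y , inj₂ (1+i≡j⇒i-j≡-1 {+ x * + m} (1+m*n≡o*p⇒ℤ x m y n eq))

i*∣b∣≡b*j : ∀ b i → ∃[ j ] i * + ∣ b ∣ ≡ b * j
i*∣b∣≡b*j b i with ℤ.+∣i∣≡i⊎+∣i∣≡-i b
... | inj₁ e = i , ≡.trans (cong (i *_) e) (ℤ.*-comm i b)
... | inj₂ e = - i , ≡.trans (cong (i *_) e) (lemma i b)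
  where
  lemma : ∀ i b → i * - b ≡ b * - i
  lemma = solve-∀

unimodular-reduce : ∀ x b y d .{{_ : ℕ.NonZero d}} →
  IsUnit (x * + d - b * y) → ∃[ a ] IsUnit (a * + d - b * + (y %ℕ d))
unimodular-reduce x b y d unit =
  x - b * (y /ℕ d) ,
  subst IsUnit (≡.trans (cong (λ z → x * + d - b * z) (a≡a%ℕn+[a/ℕn]*n y d))
                        (lemma x b (+ (y %ℕ d)) (y /ℕ d) (+ d))) unit
  where
  lemma : ∀ x b r t d → x * d - b * (r ℤ.+ t * d) ≡ (x - b * t) * d - b * r
  lemma = solve-∀

unimodular⇒coprime : ∀ {a x y c} → IsUnit (a * x - y * c) → Coprime a c
unimodular⇒coprime {a} {x} {y} {c} unit {i} (i∣a , i∣c) =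
  ∣1⇒≡1 (subst (i ∣_) (IsUnit⇒∣i∣≡1 unit) (ℤ.∣⇒∣ᵤ {+ i} i∣det))
  where
  i∣det : + i ℤ.∣ a * x - y * c
  i∣det = ℤ.∣m∣n⇒∣m-n (ℤ.∣m⇒∣m*n x (ℤ.∣ᵤ⇒∣ {+ i} {a} i∣a)) (ℤ.∣n⇒∣m*n y (ℤ.∣ᵤ⇒∣ {+ i} {c} i∣c))

det : P¹ℚ → P¹ℚ → ℤ
det α β = num α * den β - num β * den α

height : P¹ℚ → ℕ
height α = ∣ den α ∣

den≡+height : ∀ α → den α ≡ + height α
den≡+height ∞       = ≡.refl
den≡+height (fin q) = ≡.refl

det-antisym : ∀ α β → det β α ≡ - det α β
det-antisym α β = lemma (num α) (den α) (num β) (den β)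
  where
  lemma : ∀ a c b d → b * c - a * d ≡ - (a * d - b * c)
  lemma = solve-∀

det-∞ : ∀ α → det ∞ α ≡ den α
det-∞ α = lemma (num α) (den α)
  where
  lemma : ∀ b d → + 1 * d - b * + 0 ≡ d
  lemma = solve-∀

det-plücker : ∀ α β γ → den β * det α γ ≡ den γ * det α β - den α * det γ β
det-plücker α β γ = lemma (num α) (den α) (num β) (den β) (num γ) (den γ)
  where
  lemma : ∀ a c b d e f → d * (a * f - e * c) ≡ f * (a * d - b * c) - c * (e * d - b * f)
  lemma = solve-∀

Primitive-sym : ∀ α β → Primitive α β → Primitive β α
Primitive-sym α β p = subst IsUnit (≡.sym (det-antisym α β)) (IsUnit-neg p)

det≡0⇒≡ : ∀ α β → det α β ≡ 0ℤ → α ≡ β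
det≡0⇒≡ ∞       ∞       _  = ≡.refl
det≡0⇒≡ ∞       (fin q) eq with ≡.trans (≡.sym (det-∞ (fin q))) eq
... | ()
det≡0⇒≡ (fin q) ∞       eq = ≡.sym (det≡0⇒≡ ∞ (fin q) (≡.trans (det-antisym (fin q) ∞) (cong -_ eq)))
det≡0⇒≡ (fin q) (fin r) eq = cong fin (≃⇒≡ (*≡* (ℤ.i-j≡0⇒i≡j _ _ eq)))

IsUnit[i*den]⇒height≡1 : ∀ i α → IsUnit (i * den α) → height α ≡ 1
IsUnit[i*den]⇒height≡1 i α unit =
  ℕ.m*n≡1⇒n≡1 ∣ i ∣ (height α) (≡.trans (≡.sym (ℤ.abs-* i (den α))) (IsUnit⇒∣i∣≡1 unit))

height≡1⇒Primitive-∞ : ∀ α → height α ≡ 1 → Primitive ∞ α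
height≡1⇒Primitive-∞ α h = inj₁ (≡.trans (det-∞ α) (≡.trans (den≡+height α) (cong +_ h)))

equal-heights⇒height≡1 : ∀ α β → Primitive α β → height α ≡ height β → height α ≡ 1
equal-heights⇒height≡1 α β p h =
  IsUnit[i*den]⇒height≡1 (num α - num β) α (subst IsUnit det≡[a-b]*den p)
  where
  lemma : ∀ a b d → a * d - b * d ≡ (a - b) * d
  lemma = solve-∀
  det≡[a-b]*den : det α β ≡ (num α - num β) * den α
  det≡[a-b]*den = ≡.trans
    (cong (λ d → num α * d - num β * den α)
          (≡.trans (den≡+height β) (≡.trans (cong +_ (≡.sym h)) (≡.sym (den≡+height α)))))
    (lemma (num α) (num β) (den α))

lower-neighbours-adjacent : ∀ α β γ → Primitive α β → Primitive γ β →
  height α < height β → height γ < height β → α ≡ γ ⊎ Primitive α γ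
lower-neighbours-adjacent α β γ p q α<β γ<β =
  map₁ (det≡0⇒≡ α γ) (∣i∣<2⇒i≡0⊎IsUnit (det α γ) (ℕ.*-cancelˡ-< (height β) _ 2 bound))
  where
  open ℕ.≤-Reasoning
  bound : height β ℕ.* ∣ det α γ ∣ < height β ℕ.* 2
  bound = begin-strict
    height β ℕ.* ∣ det α γ ∣                   ≡⟨ ℤ.abs-* (den β) (det α γ) ⟨
    ∣ den β * det α γ ∣                         ≡⟨ cong ∣_∣ (det-plücker α β γ) ⟩
    ∣ den γ * det α β - den α * det γ β ∣       ≤⟨ ℤ.∣i-j∣≤∣i∣+∣j∣ (den γ * det α β) (den α * det γ β) ⟩
    ∣ den γ * det α β ∣ ℕ.+ ∣ den α * det γ β ∣ ≡⟨ cong₂ ℕ._+_ (∣i*u∣≡∣i∣ (den γ) p) (∣i*u∣≡∣i∣ (den α) q) ⟩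
    height γ ℕ.+ height α                       <⟨ ℕ.+-mono-< γ<β α<β ⟩
    height β ℕ.+ height β                       ≡⟨ cong (height β ℕ.+_) (ℕ.+-identityʳ (height β)) ⟨
    2 ℕ.* height β                              ≡⟨ ℕ.*-comm 2 (height β) ⟩
    height β ℕ.* 2                              ∎

unimodular-point : ∀ β a c → IsUnit (a * den β - num β * + c) → ∃[ π ] Primitive π β × height π ≡ c
unimodular-point β a zero    unit = ∞ , height≡1⇒Primitive-∞ β (IsUnit[i*den]⇒height≡1 a β unit′) , ≡.refl
  where
  lemma : ∀ a d b → a * d - b * + 0 ≡ a * d
  lemma = solve-∀
  unit′ : IsUnit (a * den β)
  unit′ = subst IsUnit (lemma a (den β) (num β)) unit
unimodular-point β a (suc k) unit = fin π , unit , ≡.refl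
  where
  π : ℚ
  π = mkℚ a k (unimodular⇒coprime {a} {den β} {num β} {+ suc k} unit)

lower-neighbour : ∀ q → ∃[ π ] Primitive π (fin q) × height π < height (fin q)
lower-neighbour q@(mkℚ b k coprime) =
  let d = suc k
      x , y , bézout = bézout⇒unimodular (coprime-Bézout (Coprimality.sym (Coprimality.recompute coprime)))
      y′ , y∣b∣≡by′  = i*∣b∣≡b*j b (+ y)
      a , reduced    = unimodular-reduce (+ x) b y′ d (subst (λ z → IsUnit (+ x * + d - z)) y∣b∣≡by′ bézout)
      π , p , h      = unimodular-point (fin q) a (y′ %ℕ d) reduced
  in π , p , subst (_< d) (≡.sym h) (n%ℕd<d y′ d)

parent : ℚ → P¹ℚ
parent q = proj₁ (lower-neighbour q)

parent-primitive : ∀ q → Primitive (parent q) (fin q)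
parent-primitive q = proj₁ (proj₂ (lower-neighbour q))

parent-lower : ∀ q → height (parent q) < height (fin q)
parent-lower q = proj₂ (proj₂ (lower-neighbour q))

module _ {c ℓ : Level} (U : Group c ℓ) where
  open Group U
  open GroupProperties U
  open SetoidReasoning setoid

  x//y∙y//z≈x//z : ∀ x y z → (x // y) ∙ (y // z) ≈ x // z
  x//y∙y//z≈x//z x y z = begin
    (x ∙ y ⁻¹) ∙ (y ∙ z ⁻¹)   ≈⟨ assoc x (y ⁻¹) (y ∙ z ⁻¹) ⟩
    x ∙ (y ⁻¹ ∙ (y ∙ z ⁻¹))   ≈⟨ ∙-congˡ (assoc (y ⁻¹) y (z ⁻¹)) ⟨
    x ∙ ((y ⁻¹ ∙ y) ∙ z ⁻¹)   ≈⟨ ∙-congˡ (∙-congʳ (inverseˡ y)) ⟩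
    x ∙ (ε ∙ z ⁻¹)            ≈⟨ ∙-congˡ (identityˡ (z ⁻¹)) ⟩
    x ∙ z ⁻¹                  ∎

  //-isPseudoMeasure : (P : P¹ℚ → Carrier) → IsPseudoMeasure U (λ α β → P β // P α)
  //-isPseudoMeasure P =
    (λ α → inverseʳ (P α)) ,
    (λ α β → trans (x//y∙y//z≈x//z _ _ _) (inverseʳ (P α))) ,
    (λ α β γ → trans (∙-congʳ (x//y∙y//z≈x//z _ _ _)) (trans (x//y∙y//z≈x//z _ _ _) (inverseʳ (P α))))

  module _ {J : P¹ℚ → P¹ℚ → Carrier} (isPseudoMeasure : IsPseudoMeasure U J) where
    pseudoMeasure-inverse : ∀ α β → J β α ≈ J α β ⁻¹
    pseudoMeasure-inverse α β = inverseˡ-unique _ _ (proj₁ (proj₂ isPseudoMeasure) α β)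

    pseudoMeasure-cocycle : ∀ α β γ → J α γ ≈ J β γ ∙ J α β
    pseudoMeasure-cocycle α β γ = trans (pseudoMeasure-inverse γ α)
      (sym (inverseʳ-unique _ _ (trans (sym (assoc _ _ _)) (proj₂ (proj₂ isPseudoMeasure) α β γ))))

    pseudoMeasure≈// : ∀ o α β → J α β ≈ J o β // J o α
    pseudoMeasure≈// o α β = trans (pseudoMeasure-cocycle α o β) (∙-congˡ (pseudoMeasure-inverse o α))

  module Extension
    (J̃ : (α β : P¹ℚ) → Primitive α β → Carrier)
    (J̃-inverseˡ : ∀ α β (p : Primitive α β) (q : Primitive β α) → J̃ β α q ∙ J̃ α β p ≈ ε)
    (J̃-triangle : ∀ α β γ (p : Primitive α β) (q : Primitive β γ) (r : Primitive γ α) →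
                    (J̃ γ α r ∙ J̃ β γ q) ∙ J̃ α β p ≈ ε)
    where

    J̃-inverse : ∀ α β (p : Primitive α β) (q : Primitive β α) → J̃ β α q ≈ J̃ α β p ⁻¹
    J̃-inverse α β p q = inverseˡ-unique _ _ (J̃-inverseˡ α β p q)

    J̃-irrelevant : ∀ α β (p p′ : Primitive α β) → J̃ α β p ≈ J̃ α β p′
    J̃-irrelevant α β p p′ =
      trans (inverseʳ-unique _ _ (J̃-inverseˡ α β p q)) (sym (inverseʳ-unique _ _ (J̃-inverseˡ α β p′ q)))
      where
      q : Primitive β α
      q = Primitive-sym α β p

    J̃-cocycle : ∀ α x β (p : Primitive α x) (q : Primitive x β) (r : Primitive α β) →
      J̃ x β q ∙ J̃ α x p ≈ J̃ α β r
    J̃-cocycle α x β p q r =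
      trans (inverseʳ-unique _ _ (trans (sym (assoc _ _ _)) (J̃-triangle α x β p q r′)))
            (sym (inverseʳ-unique _ _ (J̃-inverseˡ α β r r′)))
      where
      r′ : Primitive β α
      r′ = Primitive-sym α β r

    parentEdge : ℚ → Carrier
    parentEdge q = J̃ (parent q) (fin q) (parent-primitive q)

    potentialAcc : ∀ α → Acc _<_ (height α) → Carrier
    potentialAcc ∞       _        = ε
    potentialAcc (fin q) (acc rs) = parentEdge q ∙ potentialAcc (parent q) (rs (parent-lower q))

    potentialAcc-irrelevant : ∀ α (a a′ : Acc _<_ (height α)) → potentialAcc α a ≡ potentialAcc α a′
    potentialAcc-irrelevant ∞       _        _         = ≡.refl
    potentialAcc-irrelevant (fin q) (acc rs) (acc rs′) =
      cong (parentEdge q ∙_) (potentialAcc-irrelevant (parent q) _ _)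

    potential : P¹ℚ → Carrier
    potential α = potentialAcc α (<-wellFounded (height α))

    potentialAcc-parent : ∀ q a → potentialAcc (fin q) a ≡ parentEdge q ∙ potential (parent q)
    potentialAcc-parent q (acc rs) = cong (parentEdge q ∙_) (potentialAcc-irrelevant (parent q) _ _)

    J : P¹ℚ → P¹ℚ → Carrier
    J α β = potential β // potential α

    J-isPseudoMeasure : IsPseudoMeasure U J
    J-isPseudoMeasure = //-isPseudoMeasure potential

    extends-sym : ∀ α β (p : Primitive α β) (q : Primitive β α) → J α β ≈ J̃ α β p → J β α ≈ J̃ β α q
    extends-sym α β p q J≈J̃ = begin
      J β α             ≈⟨ pseudoMeasure-inverse J-isPseudoMeasure α β ⟩
      J α β ⁻¹          ≈⟨ ⁻¹-cong J≈J̃ ⟩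
      J̃ α β p ⁻¹        ≈⟨ J̃-inverse α β p q ⟨
      J̃ β α q           ∎

    extends-trans : ∀ α x β (p : Primitive α x) (q : Primitive x β) (r : Primitive α β) →
      J α x ≈ J̃ α x p → J x β ≈ J̃ x β q → J α β ≈ J̃ α β r
    extends-trans α x β p q r Jp≈J̃p Jq≈J̃q = begin
      J α β             ≈⟨ pseudoMeasure-cocycle J-isPseudoMeasure α x β ⟩
      J x β ∙ J α x     ≈⟨ ∙-cong Jq≈J̃q Jp≈J̃p ⟩
      J̃ x β q ∙ J̃ α x p ≈⟨ J̃-cocycle α x β p q r ⟩
      J̃ α β r           ∎

    extends-parent : ∀ q (p : Primitive (parent q) (fin q)) → J (parent q) (fin q) ≈ J̃ (parent q) (fin q) p
    extends-parent q p = begin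
      potential (fin q) // P                ≡⟨ cong (_// P) (potentialAcc-parent q (<-wellFounded _)) ⟩
      (parentEdge q ∙ P) // P               ≈⟨ //-rightDividesʳ P (parentEdge q) ⟩
      parentEdge q                          ≈⟨ J̃-irrelevant (parent q) (fin q) (parent-primitive q) p ⟩
      J̃ (parent q) (fin q) p                ∎
      where
      P : Carrier
      P = potential (parent q)

    extends-upward : ∀ k α β (p : Primitive α β) → height β ≤ k → height α < height β → J α β ≈ J̃ α β p
    extends-within : ∀ k α β (p : Primitive α β) → height α ≤ k → height β ≤ k → J α β ≈ J̃ α β p

    extends-upward zero    α β       p β≤0 α<β = contradiction (ℕ.<-≤-trans α<β β≤0) ℕ.n≮0
    extends-upward (suc k) α ∞       p _   ()
    extends-upward (suc k) α (fin q) p β≤k α<β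
      with lower-neighbours-adjacent α (fin q) (parent q) p (parent-primitive q) α<β (parent-lower q)
    ... | inj₁ ≡.refl = extends-parent q p
    ... | inj₂ r      = extends-trans α (parent q) (fin q) r (parent-primitive q) p
      (extends-within k α (parent q) r (below α<β) (below (parent-lower q)))
      (extends-parent q (parent-primitive q))
      where
      below : ∀ {n} → n < height (fin q) → n ≤ k
      below n<q = ℕ.m<1+n⇒m≤n (ℕ.<-≤-trans n<q β≤k)

    extends-within k α β p α≤k β≤k with ℕ.<-cmp (height α) (height β)
    ... | tri< α<β _ _ = extends-upward k α β p β≤k α<β
    ... | tri> _ _ β<α = extends-sym β α p′ p (extends-upward k β α p′ α≤k β<α)
      where
      p′ : Primitive β α
      p′ = Primitive-sym α β p
    ... | tri≈ _ α=β _ = extends-trans α ∞ β (Primitive-sym ∞ α ∞α) ∞β p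
      (extends-sym ∞ α ∞α (Primitive-sym ∞ α ∞α) (from-∞ α ∞α α≤k α≡1))
      (from-∞ β ∞β β≤k β≡1)
      where
      from-∞ : ∀ γ (p : Primitive ∞ γ) → height γ ≤ k → height γ ≡ 1 → J ∞ γ ≈ J̃ ∞ γ p
      from-∞ γ p γ≤k γ≡1 = extends-upward k ∞ γ p γ≤k (ℕ.≤-reflexive (≡.sym γ≡1))
      α≡1 : height α ≡ 1
      α≡1 = equal-heights⇒height≡1 α β p α=β
      β≡1 : height β ≡ 1
      β≡1 = ≡.trans (≡.sym α=β) α≡1
      ∞α : Primitive ∞ α
      ∞α = height≡1⇒Primitive-∞ α α≡1
      ∞β : Primitive ∞ β
      ∞β = height≡1⇒Primitive-∞ β β≡1

    J-extends : ∀ α β (p : Primitive α β) → J α β ≈ J̃ α β p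
    J-extends α β p = extends-within (height α ℕ.⊔ height β) α β p (ℕ.m≤m⊔n _ _) (ℕ.m≤n⊔m _ _)

    module _ (J′ : P¹ℚ → P¹ℚ → Carrier) (J′-isPseudoMeasure : IsPseudoMeasure U J′)
             (J′-extends : ∀ α β (p : Primitive α β) → J′ α β ≈ J̃ α β p) where

      potentialAcc-unique : ∀ α (a : Acc _<_ (height α)) → J′ ∞ α ≈ potentialAcc α a
      potentialAcc-unique ∞       _        = proj₁ J′-isPseudoMeasure ∞
      potentialAcc-unique (fin q) (acc rs) = begin
        J′ ∞ (fin q)
          ≈⟨ pseudoMeasure-cocycle J′-isPseudoMeasure ∞ (parent q) (fin q) ⟩
        J′ (parent q) (fin q) ∙ J′ ∞ (parent q)
          ≈⟨ ∙-cong (J′-extends _ _ _) (potentialAcc-unique (parent q) _) ⟩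
        parentEdge q ∙ potentialAcc (parent q) (rs (parent-lower q))
          ∎

      J-unique : ∀ α β → J′ α β ≈ J α β
      J-unique α β = trans (pseudoMeasure≈// J′-isPseudoMeasure ∞ α β)
        (//-cong₂ (potentialAcc-unique β (<-wellFounded _)) (potentialAcc-unique α (<-wellFounded _)))

theorem4p3 : {c ℓ : Level} (U : Group c ℓ) →
    (J̃ : (α β : P¹ℚ) → Primitive α β → Group.Carrier U) →
    (∀ α β (p : Primitive α β) (q : Primitive β α) →
      Group._≈_ U (Group._∙_ U (J̃ β α q) (J̃ α β p)) (Group.ε U)) →
    (∀ α β γ (p : Primitive α β) (q : Primitive β γ) (r : Primitive γ α) →
      Group._≈_ U (Group._∙_ U (Group._∙_ U (J̃ γ α r) (J̃ β γ q)) (J̃ α β p)) (Group.ε U)) →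
    Σ (P¹ℚ → P¹ℚ → Group.Carrier U) (λ J →
      (IsPseudoMeasure U J ×
       (∀ α β (p : Primitive α β) → Group._≈_ U (J α β) (J̃ α β p))) ×
      (∀ (J′ : P¹ℚ → P¹ℚ → Group.Carrier U) → IsPseudoMeasure U J′ →
        (∀ α β (p : Primitive α β) → Group._≈_ U (J′ α β) (J̃ α β p)) →
        ∀ α β → Group._≈_ U (J′ α β) (J α β)))
theorem4p3 U J̃ J̃-inverseˡ J̃-triangle = J , (J-isPseudoMeasure , J-extends) , J-unique
  where open Extension U J̃ J̃-inverseˡ J̃-triangle
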